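{- Let $G$ be a simple graph and let $e=v_iv_j$ be a descending edge of $G$. Then $AG(G)>AG(G-e)$.
   Context: $d_k$ denotes the degree of vertex $v_k$ in $G$, and $N(v)$ the neighbourhood of $v$; a pendent vertex has degree $1$. For an edge $v_iv_j$ with $v_j$ non-pendent, let $d_{\max}^{(j)}=\max\{d_k : v_k\in N(v_j)\setminus\{v_i\}\}$ and, if $v_i$ is non-pendent, $d_{\max}^{(i)}=\max\{d_k : v_k\in N(v_i)\setminus\{v_j\}\}$; if $v_i$ is pendent, $d_i/d_{\max}^{(i)}$ is interpreted as $+\infty$. The edge $e=v_iv_j$ (with $v_j$ non-pendent) is called descending if $\min\left\{\frac{d_i}{d_{\max}^{(i)}},\frac{d_j}{d_{\max}^{(j)}}\right\}>1$. The arithmetic-geometric index is $AG(H)=\sum_{uv\in E(H)}\frac12\left(\sqrt{d_H(u)/d_H(v)}+\sqrt{d_H(v)/d_H(u)}\right)$, degrees taken in $H$; $G-e$ is $G$ with $e$ deleted. -}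

module Defs where

open import Data.Bool using (Bool; true; false; if_then_else_; _∧_; _∨_; not)
open import Data.Nat as ℕ using (ℕ; zero; suc; _<ᵇ_; _≡ᵇ_; _⊔_)
open import Data.Fin using (Fin; toℕ)
open import Data.List using (List; []; _∷_; map; foldr; concatMap)
open import Data.Nat.ListAction using () renaming (sum to sumℕ)
open import Data.Product using (_×_; _,_; Σ; ∃)
open import Data.Sum using (_⊎_)
open import Data.Integer using (+_)
open import Data.Rational as ℚ using (ℚ; 0ℚ; _/_)
open import Relation.Binary.PropositionalEquality using (_≡_; _≢_)
open import Relation.Nullary using (¬_)

allFin : (n : ℕ) → List (Fin n)
allFin zero = []
allFin (suc n) = Fin.zero ∷ map Fin.suc (allFin n)
  where import Data.Fin as Fin

Adj : ℕ → Set
Adj n = Fin n → Fin n → Bool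

Simple : {n : ℕ} → Adj n → Set
Simple {n} A = (∀ u v → A u v ≡ A v u) × (∀ v → A v v ≡ false)

_==_ : {n : ℕ} → Fin n → Fin n → Bool
u == v = toℕ u ≡ᵇ toℕ v

deg : {n : ℕ} → Adj n → Fin n → ℕ
deg {n} A v = sumℕ (map (λ k → if A v k then 1 else 0) (allFin n))

-- d_max^{(j)} w.r.t. excluded neighbour i : max{ d_k : v_k ∈ N(v_j) \ {v_i} }
-- (0 if that set is empty; it is only used when it is nonempty)
dmax : {n : ℕ} → Adj n → (j i : Fin n) → ℕ
dmax {n} A j i =
  foldr _⊔_ 0 (map (λ k → if A j k ∧ not (k == i) then deg A k else 0) (allFin n))

-- e = v_i v_j (v_j non-pendent) is descending.
-- Since all degrees involved are positive naturals, d / dmax > 1 ⇔ dmax < d.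
-- For pendent v_i, d_i / dmax^{(i)} = +∞ > 1.
Descending : {n : ℕ} → Adj n → (i j : Fin n) → Set
Descending A i j =
  A i j ≡ true
  × deg A j ≢ 1
  × (deg A i ≡ 1 ⊎ dmax A i j ℕ.< deg A i)
  × dmax A j i ℕ.< deg A j

deleteEdge : {n : ℕ} → Adj n → (i j : Fin n) → Adj n
deleteEdge A i j u v =
  A u v ∧ not ((u == i ∧ v == j) ∨ (u == j ∧ v == i))

edges : {n : ℕ} → Adj n → List (Fin n × Fin n)
edges {n} A =
  concatMap (λ u → concatMap (λ v → if A u v ∧ (toℕ u <ᵇ toℕ v) then (u , v) ∷ [] else [])
                               (allFin n))
            (allFin n)

-- Real-valued AG comparison, encoded via rational bounds.
-- The AG-term of an edge uv with degrees a = d(u), b = d(v) is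
--   t(a,b) = ½(√(a/b) + √(b/a)) = (a+b) / (2√(ab))  (a, b ≥ 1).
-- For a rational q:
--   q ≤ t(a,b)  ⇔  q ≤ 0  or  4 q² a b ≤ (a+b)²
--   t(a,b) ≤ q  ⇔  0 ≤ q  and (a+b)² ≤ 4 q² a b

ℕ→ℚ : ℕ → ℚ
ℕ→ℚ n = (+ n) / 1

LowerAG : ℕ → ℕ → ℚ → Set
LowerAG a b q =
  q ℚ.≤ 0ℚ ⊎ (ℕ→ℚ 4 ℚ.* q ℚ.* q ℚ.* ℕ→ℚ a ℚ.* ℕ→ℚ b ℚ.≤ ℕ→ℚ ((a ℕ.+ b) ℕ.* (a ℕ.+ b)))

UpperAG : ℕ → ℕ → ℚ → Set
UpperAG a b q =
  0ℚ ℚ.≤ q × (ℕ→ℚ ((a ℕ.+ b) ℕ.* (a ℕ.+ b)) ℚ.≤ ℕ→ℚ 4 ℚ.* q ℚ.* q ℚ.* ℕ→ℚ a ℚ.* ℕ→ℚ b)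

data AllL {X : Set} (P : X → Set) : List X → Set where
  []  : AllL P []
  _∷_ : ∀ {x xs} → P x → AllL P xs → AllL P (x ∷ xs)

sumℚ : List ℚ → ℚ
sumℚ = foldr ℚ._+_ 0ℚ

edgeSum : {n : ℕ} → Adj n → (Fin n → Fin n → ℚ) → ℚ
edgeSum A q = sumℚ (map (λ e → q (Data.Product.proj₁ e) (Data.Product.proj₂ e)) (edges A))
  where import Data.Product

-- AG(G) > AG(H) as a strict inequality of real numbers:
-- there is a rational lower bound for every AG-term of G and a rational upper
-- bound for every AG-term of H with  Σ lower (G) > Σ upper (H).
-- (For finite sums of reals, x > y holds iff such rational bounds exist.)
_AG>_ : {n : ℕ} → Adj n → Adj n → Set
_AG>_ {n} G H =
  Σ (Fin n → Fin n → ℚ) λ l → Σ (Fin n → Fin n → ℚ) λ u →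
    AllL (λ e → LowerAG (deg G (Data.Product.proj₁ e)) (deg G (Data.Product.proj₂ e))
                        (l (Data.Product.proj₁ e) (Data.Product.proj₂ e))) (edges G)
    × AllL (λ e → UpperAG (deg H (Data.Product.proj₁ e)) (deg H (Data.Product.proj₂ e))
                          (u (Data.Product.proj₁ e) (Data.Product.proj₂ e))) (edges H)
    × edgeSum H u ℚ.< edgeSum G l
  where import Data.Product

{-# OPTIONS --safe #-}
-- Deleting e = v_iv_j lowers only d_i and d_j, each by one. On a remaining edge v_iv the other
-- endpoint keeps its degree d_v ≤ d_max^{(i)} < d_i, so d_v ≤ d_i − 1; as AG(a, b) = (a + b)/(2√(ab))
-- increases in its larger argument, the term of v_iv does not increase, and likewise at v_j. So
-- every term of G − e is at most the corresponding term of G, and G has the extra term AG ≥ 1.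
-- The real inequality is certified by rounding at scale K = |E(G − e)| + 1: each term t of G is
-- bounded below by ⌊Kt⌋/K, each term of G − e above by (⌊Kt⌋ + 1)/K. The rounding costs at most
-- |E(G − e)|/K < 1 in total, while the deleted edge alone contributes ⌊Kt⌋/K ≥ 1.
module Submission where

open import Defs
open import Data.Bool using (Bool; true; false; if_then_else_; _∧_; _∨_; not)
open import Data.Bool.Properties using (T-≡; ∧-identityʳ; ∧-zeroʳ; ∨-identityʳ; ∨-comm; ∧-comm)
open import Data.Empty using (⊥-elim)
open import Data.Fin as Fin using (Fin; toℕ)
open import Data.Fin.Properties using (toℕ-injective; _≟_)
open import Data.Integer as ℤ using (+_)
import Data.Integer.Properties as ℤₚ
open import Data.List using (List; []; _∷_; _++_; map; foldr; concatMap; filterᵇ; cartesianProduct; length)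
open import Data.List.Properties using (filter-++; map-∘; map-cong)
open import Data.List.Membership.Propositional using (_∈_)
open import Data.List.Membership.Propositional.Properties using (∈-map⁺; ∈-cartesianProduct⁺)
open import Data.List.Relation.Unary.Any using (here; there)
open import Data.Nat using (ℕ; zero; suc; _+_; _*_; _≤_; _<_; _≤?_; _⊔_; _<ᵇ_; z≤n; >-nonZero)
open import Data.Nat.Properties hiding (_≟_)
open import Data.Nat.ListAction using (sum)
open import Data.Nat.Tactic.RingSolver using (solve-∀)
open import Data.Nat.Coprimality as Coprime using (1-coprimeTo)
open import Data.Product using (_×_; _,_; proj₁; proj₂; ∃-syntax)
open import Data.Rational as ℚ using (ℚ; mkℚ; 0ℚ; 1ℚ)
import Data.Rational.Properties as ℚₚ
open import Data.Rational.Solver using (module +-*-Solver)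
open import Data.Sum using (_⊎_; inj₁; inj₂; [_,_]′)
open import Function using (_∘_; Equivalence)
open import Level using (0ℓ)
open import Relation.Binary using (tri<; tri≈; tri>)
open import Relation.Binary.PropositionalEquality
open import Relation.Nullary using (¬_; yes; no; does)
open import Relation.Nullary.Decidable using (_⊎-dec_; T?)
open import Relation.Unary using (Pred; Decidable)

private variable
  n : ℕ
  u v w : Fin n

-- AG(a′, b′) ≤ AG(a, b) for AG(a, b) = (a + b)/(2√(ab)), squared and cleared of denominators.
data _≼_ : ℕ × ℕ → ℕ × ℕ → Set where
  cross : ∀ {a′ b′ a b} → (a′ + b′) * (a′ + b′) * (a * b) ≤ (a + b) * (a + b) * (a′ * b′) → (a′ , b′) ≼ (a , b)

≼-refl : ∀ {a b} → (a , b) ≼ (a , b)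
≼-refl = cross ≤-refl

≼-swap : ∀ {a′ b′ a b} → (a′ , b′) ≼ (a , b) → (b′ , a′) ≼ (b , a)
≼-swap {a′} {b′} {a} {b} (cross le) = cross (subst₂ _≤_ (swap a′ b′ a b) (swap a b a′ b′) le)
  where
  swap : ∀ x y z t → (x + y) * (x + y) * (z * t) ≡ (y + x) * (y + x) * (t * z)
  swap = solve-∀

≼-step : ∀ {b c} → b ≤ c → (c , b) ≼ (suc c , b)
≼-step {b} b≤c with d , refl ← m≤n⇒∃[o]m+o≡n b≤c =
  cross (subst ((b + d + b) * (b + d + b) * (suc (b + d) * b) ≤_) (gap b d) (m≤m+n _ _))
  where
  gap : ∀ b d → (b + d + b) * (b + d + b) * ((1 + (b + d)) * b) + b * (2 * b * d + d * d + b + d)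
                ≡ (1 + (b + d) + b) * (1 + (b + d) + b) * ((b + d) * b)
  gap = solve-∀

4ab≤[a+b]² : ∀ a b → 4 * (a * b) ≤ (a + b) * (a + b)
4ab≤[a+b]² a b = [ ordered , (λ b≤a → subst₂ _≤_ (cong (4 *_) (*-comm b a)) (cong (λ s → s * s) (+-comm b a))
                                                 (ordered b≤a)) ]′ (≤-total a b)
  where
  gap : ∀ a d → 4 * (a * (a + d)) + d * d ≡ (a + (a + d)) * (a + (a + d))
  gap = solve-∀
  ordered : ∀ {a b} → a ≤ b → 4 * (a * b) ≤ (a + b) * (a + b)
  ordered {a} a≤b with d , refl ← m≤n⇒∃[o]m+o≡n a≤b = subst (4 * (a * (a + d)) ≤_) (gap a d) (m≤m+n _ (d * d))

module _ {P : Pred ℕ 0ℓ} (P? : Decidable P) where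

  greatest : ℕ → ℕ
  greatest zero = zero
  greatest (suc m) with does (P? (suc m))
  ... | true = suc m
  ... | false = greatest m

  greatest-satisfies : P 0 → ∀ m → P (greatest m)
  greatest-satisfies P0 zero = P0
  greatest-satisfies P0 (suc m) with P? (suc m)
  ... | yes Pm = Pm
  ... | no _ = greatest-satisfies P0 m

  ≤-greatest : ∀ {x} m → x ≤ m → P x → x ≤ greatest m
  ≤-greatest zero x≤0 _ = x≤0
  ≤-greatest (suc m) x≤m Px with P? (suc m)
  ... | yes _ = x≤m
  ... | no ¬Pm with m≤n⇒m<n∨m≡n x≤m
  ...   | inj₁ x<1+m = ≤-greatest m (≤-pred x<1+m) Px
  ...   | inj₂ refl = ⊥-elim (¬Pm Px)

-- x / K ≤ AG(a, b) and AG(a, b) ≤ x / K, squared and cleared of denominators.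
ScaledLower ScaledUpper : ℕ → ℕ → ℕ → ℕ → Set
ScaledLower K a b x = 4 * x * x * a * b ≤ (a + b) * (a + b) * (K * K)
ScaledUpper K a b x = (a + b) * (a + b) * (K * K) ≤ 4 * x * x * a * b

scaledLower? : ∀ K a b → Decidable (ScaledLower K a b)
scaledLower? K a b x = 4 * x * x * a * b ≤? (a + b) * (a + b) * (K * K)

-- ⌊K · AG(a, b)⌋; the search bound (a + b) K is large enough as soon as ab ≥ 1.
agFloor : ℕ → ℕ → ℕ → ℕ
agFloor K a b = greatest (scaledLower? K a b) ((a + b) * K)

agFloor-lower : ∀ K a b → ScaledLower K a b (agFloor K a b)
agFloor-lower K a b = greatest-satisfies (scaledLower? K a b) z≤n ((a + b) * K)

ScaledLower⇒≤ : ∀ {K a b x} → 0 < a * b → ScaledLower K a b x → x ≤ (a + b) * K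
ScaledLower⇒≤ {K} {a} {b} {x} ab>0 lower = ^2-cancel (begin
  x * x                             ≤⟨ m≤m*n (x * x) (4 * (a * b)) {{>-nonZero (≤-trans ab>0 (m≤n*m (a * b) 4))}} ⟩
  x * x * (4 * (a * b))             ≡⟨ reorder x a b ⟩
  4 * x * x * a * b                 ≤⟨ lower ⟩
  (a + b) * (a + b) * (K * K)       ≡⟨ regroup a b K ⟩
  (a + b) * K * ((a + b) * K)       ∎)
  where
  open ≤-Reasoning
  reorder : ∀ x a b → x * x * (4 * (a * b)) ≡ 4 * x * x * a * b
  reorder = solve-∀
  regroup : ∀ a b K → (a + b) * (a + b) * (K * K) ≡ (a + b) * K * ((a + b) * K)
  regroup = solve-∀
  ^2-cancel : ∀ {m n} → m * m ≤ n * n → m ≤ n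
  ^2-cancel {m} {n} m²≤n² with m ≤? n
  ... | yes m≤n = m≤n
  ... | no m≰n = ⊥-elim (<⇒≱ (*-mono-< (≰⇒> m≰n) (≰⇒> m≰n)) m²≤n²)

≤-agFloor : ∀ {K a b x} → 0 < a * b → ScaledLower K a b x → x ≤ agFloor K a b
≤-agFloor {K} {a} {b} ab>0 lower = ≤-greatest (scaledLower? K a b) _ (ScaledLower⇒≤ ab>0 lower) lower

agFloor-upper : ∀ K a b → 0 < a * b → ScaledUpper K a b (suc (agFloor K a b))
agFloor-upper K a b ab>0 with scaledLower? K a b (suc (agFloor K a b))
... | yes lower = ⊥-elim (<-irrefl refl (≤-agFloor {a = a} {b} ab>0 lower))
... | no ¬lower = <⇒≤ (≰⇒> ¬lower)

K≤agFloor : ∀ K a b → 0 < a * b → K ≤ agFloor K a b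
K≤agFloor K a b ab>0 =
  ≤-agFloor {a = a} {b} ab>0 (subst₂ _≤_ (reorder a b K) refl (*-monoˡ-≤ (K * K) (4ab≤[a+b]² a b)))
  where
  reorder : ∀ a b K → 4 * (a * b) * (K * K) ≡ 4 * K * K * a * b
  reorder = solve-∀

agFloor-mono : ∀ K {a′ b′ a b} → (a′ , b′) ≼ (a , b) → 0 < a′ * b′ → 0 < a * b → agFloor K a′ b′ ≤ agFloor K a b
agFloor-mono K {a′} {b′} {a} {b} (cross a′b′≼ab) a′b′>0 ab>0 =
  ≤-agFloor {a = a} {b} ab>0
    (*-cancelˡ-≤ (a′ * b′) {{>-nonZero a′b′>0}} (chain (agFloor K a′ b′) (agFloor-lower K a′ b′)))
  where
  open ≤-Reasoning
  e₁ : ∀ a′ b′ a b k → a′ * b′ * (4 * k * k * a * b) ≡ 4 * k * k * a′ * b′ * (a * b)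
  e₁ = solve-∀
  e₂ : ∀ a′ b′ a b K → (a′ + b′) * (a′ + b′) * (K * K) * (a * b) ≡ K * K * ((a′ + b′) * (a′ + b′) * (a * b))
  e₂ = solve-∀
  e₃ : ∀ a′ b′ a b K → K * K * ((a + b) * (a + b) * (a′ * b′)) ≡ a′ * b′ * ((a + b) * (a + b) * (K * K))
  e₃ = solve-∀
  chain : ∀ k → ScaledLower K a′ b′ k → a′ * b′ * (4 * k * k * a * b) ≤ a′ * b′ * ((a + b) * (a + b) * (K * K))
  chain k lower = begin
    a′ * b′ * (4 * k * k * a * b)                  ≡⟨ e₁ a′ b′ a b k ⟩
    4 * k * k * a′ * b′ * (a * b)                  ≤⟨ *-monoˡ-≤ (a * b) lower ⟩
    (a′ + b′) * (a′ + b′) * (K * K) * (a * b)      ≡⟨ e₂ a′ b′ a b K ⟩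
    K * K * ((a′ + b′) * (a′ + b′) * (a * b))      ≤⟨ *-monoʳ-≤ (K * K) a′b′≼ab ⟩
    K * K * ((a + b) * (a + b) * (a′ * b′))        ≡⟨ e₃ a′ b′ a b K ⟩
    a′ * b′ * ((a + b) * (a + b) * (K * K))        ∎

ℕ→ℚ-mkℚ : ∀ m → ℕ→ℚ m ≡ mkℚ (+ m) 0 (Coprime.sym (1-coprimeTo m))
ℕ→ℚ-mkℚ m = ℚₚ.↥p/↧p≡p _

ℕ→ℚ-homo-+ : ∀ m n → ℕ→ℚ (m + n) ≡ ℕ→ℚ m ℚ.+ ℕ→ℚ n
ℕ→ℚ-homo-+ m n = trans (ℚₚ./-cong (sym (cong₂ ℤ._+_ (ℤₚ.*-identityʳ (+ m)) (ℤₚ.*-identityʳ (+ n)))) refl)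
                       (sym (cong₂ ℚ._+_ (ℕ→ℚ-mkℚ m) (ℕ→ℚ-mkℚ n)))

ℕ→ℚ-homo-* : ∀ m n → ℕ→ℚ (m * n) ≡ ℕ→ℚ m ℚ.* ℕ→ℚ n
ℕ→ℚ-homo-* m n = trans (ℚₚ./-cong (ℤₚ.pos-* m n) refl) (sym (cong₂ ℚ._*_ (ℕ→ℚ-mkℚ m) (ℕ→ℚ-mkℚ n)))

ℕ→ℚ-mono-≤ : ∀ {m n} → m ≤ n → ℕ→ℚ m ℚ.≤ ℕ→ℚ n
ℕ→ℚ-mono-≤ {m} {n} m≤n rewrite ℕ→ℚ-mkℚ m | ℕ→ℚ-mkℚ n =
  ℚ.*≤* (subst₂ ℤ._≤_ (sym (ℤₚ.*-identityʳ (+ m))) (sym (ℤₚ.*-identityʳ (+ n))) (ℤ.+≤+ m≤n))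

ℕ→ℚ-mono-< : ∀ {m n} → m < n → ℕ→ℚ m ℚ.< ℕ→ℚ n
ℕ→ℚ-mono-< {m} {n} m<n rewrite ℕ→ℚ-mkℚ m | ℕ→ℚ-mkℚ n =
  ℚ.*<* (subst₂ ℤ._<_ (sym (ℤₚ.*-identityʳ (+ m))) (sym (ℤₚ.*-identityʳ (+ n))) (ℤ.+<+ m<n))

-- 1/(N + 1) written in normal form, so that instance search sees that it is positive
1/suc_ : ℕ → ℚ
1/suc N = mkℚ (+ 1) N (1-coprimeTo (suc N))

_/suc_ : ℕ → ℕ → ℚ
k /suc N = ℕ→ℚ k ℚ.* 1/suc N

module _ (N : ℕ) where

  private
    K : ℕ
    K = suc N
    K⁻² : ℚ
    K⁻² = 1/suc N ℚ.* 1/suc N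

  ℕ→ℚ-unscale : ∀ c → ℕ→ℚ c ≡ ℕ→ℚ (c * (K * K)) ℚ.* K⁻²
  ℕ→ℚ-unscale c = sym (begin
    ℕ→ℚ (c * (K * K)) ℚ.* K⁻²
      ≡⟨ cong (ℚ._* K⁻²) (trans (ℕ→ℚ-homo-* c (K * K)) (cong (ℕ→ℚ c ℚ.*_) (ℕ→ℚ-homo-* K K))) ⟩
    ℕ→ℚ c ℚ.* (ℕ→ℚ K ℚ.* ℕ→ℚ K) ℚ.* K⁻²
      ≡⟨ regroup (ℕ→ℚ c) (ℕ→ℚ K) (1/suc N) ⟩
    ℕ→ℚ c ℚ.* ((ℕ→ℚ K ℚ.* 1/suc N) ℚ.* (ℕ→ℚ K ℚ.* 1/suc N))
      ≡⟨ cong (λ x → ℕ→ℚ c ℚ.* (x ℚ.* x)) K*1/K ⟩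
    ℕ→ℚ c ℚ.* (1ℚ ℚ.* 1ℚ)
      ≡⟨ ℚₚ.*-identityʳ (ℕ→ℚ c) ⟩
    ℕ→ℚ c ∎)
    where
    open ≡-Reasoning
    open +-*-Solver
    regroup : ∀ c k w → c ℚ.* (k ℚ.* k) ℚ.* (w ℚ.* w) ≡ c ℚ.* ((k ℚ.* w) ℚ.* (k ℚ.* w))
    regroup = solve 3 (λ c k w → c :* (k :* k) :* (w :* w) := c :* ((k :* w) :* (k :* w))) refl
    K*1/K : ℕ→ℚ K ℚ.* 1/suc N ≡ 1ℚ
    K*1/K rewrite ℕ→ℚ-mkℚ K = ℚₚ.*-inverseʳ (mkℚ (+ K) 0 (Coprime.sym (1-coprimeTo K)))

  4[k/K]²ab≡ : ∀ k a b →
    ℕ→ℚ 4 ℚ.* (k /suc N) ℚ.* (k /suc N) ℚ.* ℕ→ℚ a ℚ.* ℕ→ℚ b ≡ ℕ→ℚ (4 * k * k * a * b) ℚ.* K⁻²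
  4[k/K]²ab≡ k a b = begin
    ℕ→ℚ 4 ℚ.* (k /suc N) ℚ.* (k /suc N) ℚ.* ℕ→ℚ a ℚ.* ℕ→ℚ b
      ≡⟨ regroup (ℕ→ℚ 4) (ℕ→ℚ k) (ℕ→ℚ a) (ℕ→ℚ b) (1/suc N) ⟩
    ℕ→ℚ 4 ℚ.* ℕ→ℚ k ℚ.* ℕ→ℚ k ℚ.* ℕ→ℚ a ℚ.* ℕ→ℚ b ℚ.* K⁻²
      ≡⟨ cong (ℚ._* K⁻²) (sym homo) ⟩
    ℕ→ℚ (4 * k * k * a * b) ℚ.* K⁻² ∎
    where
    open ≡-Reasoning
    open +-*-Solver
    regroup : ∀ f k a b w → f ℚ.* (k ℚ.* w) ℚ.* (k ℚ.* w) ℚ.* a ℚ.* b ≡ f ℚ.* k ℚ.* k ℚ.* a ℚ.* b ℚ.* (w ℚ.* w)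
    regroup = solve 5 (λ f k a b w → f :* (k :* w) :* (k :* w) :* a :* b := f :* k :* k :* a :* b :* (w :* w)) refl
    homo : ℕ→ℚ (4 * k * k * a * b) ≡ ℕ→ℚ 4 ℚ.* ℕ→ℚ k ℚ.* ℕ→ℚ k ℚ.* ℕ→ℚ a ℚ.* ℕ→ℚ b
    homo = trans (ℕ→ℚ-homo-* (4 * k * k * a) b) (cong (ℚ._* ℕ→ℚ b)
           (trans (ℕ→ℚ-homo-* (4 * k * k) a) (cong (ℚ._* ℕ→ℚ a)
           (trans (ℕ→ℚ-homo-* (4 * k) k) (cong (ℚ._* ℕ→ℚ k) (ℕ→ℚ-homo-* 4 k))))))

  scale-mono-≤ : ∀ {x y} → x ≤ y → ℕ→ℚ x ℚ.* K⁻² ℚ.≤ ℕ→ℚ y ℚ.* K⁻²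
  scale-mono-≤ x≤y =
    ℚₚ.*-monoʳ-≤-nonNeg K⁻² {{ℚₚ.pos⇒nonNeg K⁻² {{ℚₚ.pos*pos⇒pos (1/suc N) (1/suc N)}}}} (ℕ→ℚ-mono-≤ x≤y)

  ScaledLower⇒LowerAG : ∀ a b k → ScaledLower K a b k → LowerAG a b (k /suc N)
  ScaledLower⇒LowerAG a b k lower =
    inj₂ (subst₂ ℚ._≤_ (sym (4[k/K]²ab≡ k a b)) (sym (ℕ→ℚ-unscale ((a + b) * (a + b)))) (scale-mono-≤ lower))

  ScaledUpper⇒UpperAG : ∀ a b k → ScaledUpper K a b k → UpperAG a b (k /suc N)
  ScaledUpper⇒UpperAG a b k upper =
    /suc-nonNeg ,
    subst₂ ℚ._≤_ (sym (ℕ→ℚ-unscale ((a + b) * (a + b)))) (sym (4[k/K]²ab≡ k a b)) (scale-mono-≤ upper)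
    where
    /suc-nonNeg : 0ℚ ℚ.≤ k /suc N
    /suc-nonNeg =
      subst (ℚ._≤ k /suc N) (ℚₚ.*-zeroˡ (1/suc N)) (ℚₚ.*-monoʳ-≤-nonNeg (1/suc N) (ℕ→ℚ-mono-≤ {n = k} z≤n))

  /suc-mono-< : ∀ {m n} → m < n → m /suc N ℚ.< n /suc N
  /suc-mono-< m<n = ℚₚ.*-monoˡ-<-pos (1/suc N) (ℕ→ℚ-mono-< m<n)

  sumℚ-/suc : ∀ {X : Set} (h : X → ℕ) xs → sumℚ (map (λ x → h x /suc N) xs) ≡ sum (map h xs) /suc N
  sumℚ-/suc h [] = sym (ℚₚ.*-zeroˡ (1/suc N))
  sumℚ-/suc h (x ∷ xs) = begin
    h x /suc N ℚ.+ sumℚ (map (λ x → h x /suc N) xs)    ≡⟨ cong (h x /suc N ℚ.+_) (sumℚ-/suc h xs) ⟩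
    h x /suc N ℚ.+ sum (map h xs) /suc N                ≡⟨ ℚₚ.*-distribʳ-+ (1/suc N) (ℕ→ℚ (h x)) _ ⟨
    (ℕ→ℚ (h x) ℚ.+ ℕ→ℚ (sum (map h xs))) ℚ.* 1/suc N   ≡⟨ cong (ℚ._* 1/suc N) (ℕ→ℚ-homo-+ (h x) _) ⟨
    (h x + sum (map h xs)) /suc N                       ∎
    where open ≡-Reasoning

module _ {X : Set} where

  sum-map-+ : ∀ (f g : X → ℕ) xs → sum (map (λ x → f x + g x) xs) ≡ sum (map f xs) + sum (map g xs)
  sum-map-+ f g [] = refl
  sum-map-+ f g (x ∷ xs) = trans (cong (_+_ (f x + g x)) (sum-map-+ f g xs)) (interchange (f x) (g x) _ _)
    where
    interchange : ∀ a b c d → a + b + (c + d) ≡ a + c + (b + d)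
    interchange = solve-∀

  sum-map-suc : ∀ (f : X → ℕ) xs → sum (map (suc ∘ f) xs) ≡ sum (map f xs) + length xs
  sum-map-suc f [] = refl
  sum-map-suc f (x ∷ xs) = trans (cong (λ s → suc (f x + s)) (sum-map-suc f xs)) (rearrange (f x) _ _)
    where
    rearrange : ∀ a s l → suc (a + (s + l)) ≡ a + s + suc l
    rearrange = solve-∀

  sum-map-0 : ∀ (xs : List X) → sum (map (λ _ → 0) xs) ≡ 0
  sum-map-0 [] = refl
  sum-map-0 (x ∷ xs) = sum-map-0 xs

  module _ {p q : X → Bool} {f g : X → ℕ} (q⇒p : ∀ {x} → q x ≡ true → p x ≡ true × f x ≤ g x) where

    sum-filter-≤ : ∀ xs → sum (map f (filterᵇ q xs)) ≤ sum (map g (filterᵇ p xs))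
    sum-filter-≤ [] = z≤n
    sum-filter-≤ (x ∷ xs) with q x in qx | p x in px
    ... | true  | true  = +-mono-≤ (proj₂ (q⇒p qx)) (sum-filter-≤ xs)
    ... | true  | false with () ← trans (sym px) (proj₁ (q⇒p qx))
    ... | false | true  = ≤-trans (sum-filter-≤ xs) (m≤n+m _ (g x))
    ... | false | false = sum-filter-≤ xs

    sum-filter-< : ∀ {x₀ xs} → x₀ ∈ xs → p x₀ ≡ true → q x₀ ≡ false →
                   sum (map f (filterᵇ q xs)) + g x₀ ≤ sum (map g (filterᵇ p xs))
    sum-filter-< {x₀} {_ ∷ xs} (here refl) px₀ qx₀ rewrite px₀ | qx₀ =
      ≤-trans (≤-reflexive (+-comm _ (g x₀))) (+-monoʳ-≤ (g x₀) (sum-filter-≤ xs))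
    sum-filter-< {x₀} {x ∷ xs} (there x₀∈xs) px₀ qx₀ with q x in qx | p x in px
    ... | true  | true  = ≤-trans (≤-reflexive (+-assoc (f x) _ (g x₀)))
                                  (+-mono-≤ (proj₂ (q⇒p qx)) (sum-filter-< x₀∈xs px₀ qx₀))
    ... | true  | false with () ← trans (sym px) (proj₁ (q⇒p qx))
    ... | false | true  = ≤-trans (sum-filter-< x₀∈xs px₀ qx₀) (m≤n+m _ (g x))
    ... | false | false = sum-filter-< x₀∈xs px₀ qx₀

  AllL-filterᵇ : ∀ {P : X → Set} {p : X → Bool} → (∀ {x} → p x ≡ true → P x) → ∀ xs → AllL P (filterᵇ p xs)
  AllL-filterᵇ p⇒P [] = []
  AllL-filterᵇ {p = p} p⇒P (x ∷ xs) with p x in px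
  ... | true  = p⇒P px ∷ AllL-filterᵇ p⇒P xs
  ... | false = AllL-filterᵇ p⇒P xs

∈⇒≤-sum : ∀ {x xs} → x ∈ xs → x ≤ sum xs
∈⇒≤-sum (here refl) = m≤m+n _ _
∈⇒≤-sum (there x∈xs) = ≤-trans (∈⇒≤-sum x∈xs) (m≤n+m _ _)

∈⇒≤-max : ∀ {x xs} → x ∈ xs → x ≤ foldr _⊔_ 0 xs
∈⇒≤-max (here refl) = m≤m⊔n _ _
∈⇒≤-max (there x∈xs) = ≤-trans (∈⇒≤-max x∈xs) (m≤n⊔m _ _)

∈-allFin : (k : Fin n) → k ∈ allFin n
∈-allFin Fin.zero = here refl
∈-allFin (Fin.suc k) = there (∈-map⁺ Fin.suc (∈-allFin k))

==⇒≡ : (u == v) ≡ true → u ≡ v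
==⇒≡ {u = u} {v} u==v = toℕ-injective (≡ᵇ⇒≡ (toℕ u) (toℕ v) (Equivalence.from T-≡ u==v))

==-refl : (u : Fin n) → (u == u) ≡ true
==-refl u = Equivalence.to T-≡ (≡⇒≡ᵇ (toℕ u) (toℕ u) refl)

≢⇒==-false : u ≢ v → (u == v) ≡ false
≢⇒==-false {u = u} {v} u≢v with u == v in u==v
... | true  = ⊥-elim (u≢v (==⇒≡ u==v))
... | false = refl

indicator : Bool → ℕ
indicator b = if b then 1 else 0

count-== : (j : Fin n) → sum (map (λ k → indicator (k == j)) (allFin n)) ≡ 1
count-== {suc n} Fin.zero = cong suc (trans (cong sum (sym (map-∘ (allFin n)))) (sum-map-0 (allFin n)))
count-== {suc n} (Fin.suc j) = trans (cong sum (sym (map-∘ (allFin n)))) (count-== j)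

module _ {n : ℕ} (A : Adj n) where

  adj⇒≢ : (∀ v → A v v ≡ false) → A u v ≡ true → u ≢ v
  adj⇒≢ A-irrefl Auv refl with () ← trans (sym Auv) (A-irrefl _)

  adj⇒0<deg : A u v ≡ true → 0 < deg A u
  adj⇒0<deg {u} {v} Auv =
    subst (_≤ deg A u) (cong indicator Auv) (∈⇒≤-sum (∈-map⁺ (λ k → indicator (A u k)) (∈-allFin v)))

  adj⇒0<deg* : (∀ u v → A u v ≡ A v u) → A u v ≡ true → 0 < deg A u * deg A v
  adj⇒0<deg* {u} {v} A-sym Auv = *-mono-≤ (adj⇒0<deg Auv) (adj⇒0<deg (trans (A-sym v u) Auv))

  dmax-≥ : A u v ≡ true → v ≢ w → deg A v ≤ dmax A u w
  dmax-≥ {u} {v} {w} Auv v≢w = subst (_≤ dmax A u w) value (∈⇒≤-max (∈-map⁺ _ (∈-allFin v)))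
    where
    value : (if A u v ∧ not (v == w) then deg A v else 0) ≡ deg A v
    value rewrite Auv | ≢⇒==-false v≢w = refl

deg-cong : (A B : Adj n) → (∀ k → A u k ≡ B v k) → deg A u ≡ deg B v
deg-cong {n} A B eq = cong sum (map-cong (cong indicator ∘ eq) (allFin n))

module _ {n : ℕ} (G : Adj n) (i j : Fin n) where

  private
    H : Adj n
    H = deleteEdge G i j

  deleteEdge⇒ : H u v ≡ true → G u v ≡ true
  deleteEdge⇒ {u} {v} Huv with G u v
  ... | true = refl

  deleteEdge-comm : H u v ≡ deleteEdge G j i u v
  deleteEdge-comm {u} {v} = cong (λ b → G u v ∧ not b) (∨-comm (u == i ∧ v == j) (u == j ∧ v == i))

  deleteEdge-sym : (∀ u v → G u v ≡ G v u) → H u v ≡ H v u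
  deleteEdge-sym {u} {v} G-sym = cong₂ (λ a b → a ∧ not b) (G-sym u v)
    (trans (∨-comm (u == i ∧ v == j) _) (cong₂ _∨_ (∧-comm (u == j) (v == i)) (∧-comm (u == i) (v == j))))

  deleteEdge-away : u ≢ i → u ≢ j → H u v ≡ G u v
  deleteEdge-away u≢i u≢j rewrite ≢⇒==-false u≢i | ≢⇒==-false u≢j = ∧-identityʳ _

  deleteEdge-row : i ≢ j → H i v ≡ G i v ∧ not (v == j)
  deleteEdge-row {v} i≢j rewrite ==-refl i | ≢⇒==-false i≢j = cong (λ b → G i v ∧ not b) (∨-identityʳ (v == j))

  deleteEdge-removes : i ≢ j → H i j ≡ false
  deleteEdge-removes i≢j rewrite deleteEdge-row {j} i≢j | ==-refl j = ∧-zeroʳ (G i j)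

  deg-deleteEdge : i ≢ j → G i j ≡ true → deg G i ≡ suc (deg H i)
  deg-deleteEdge i≢j Gij = begin
    deg G i
      ≡⟨ cong sum (map-cong split (allFin n)) ⟩
    sum (map (λ k → indicator (G i k ∧ not (k == j)) + indicator (k == j)) (allFin n))
      ≡⟨ sum-map-+ (λ k → indicator (G i k ∧ not (k == j))) (λ k → indicator (k == j)) (allFin n) ⟩
    sum (map (λ k → indicator (G i k ∧ not (k == j))) (allFin n)) + sum (map (λ k → indicator (k == j)) (allFin n))
      ≡⟨ cong₂ _+_ (cong sum (map-cong (λ k → cong indicator (sym (deleteEdge-row i≢j))) (allFin n))) (count-== j) ⟩
    deg H i + 1
      ≡⟨ +-comm _ 1 ⟩
    suc (deg H i) ∎
    where
    open ≡-Reasoning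
    split : ∀ k → indicator (G i k) ≡ indicator (G i k ∧ not (k == j)) + indicator (k == j)
    split k with G i k in Gik | k == j in k==j
    ... | true  | true  = refl
    ... | true  | false = refl
    ... | false | false = refl
    ... | false | true with () ← trans (sym Gik) (trans (cong (G i) (==⇒≡ k==j)) Gij)

  -- Along an edge iv of G − ij the vertex v keeps its degree, which is below d_i by the descending
  -- condition (if d_i = 1 there is no such edge), hence at most the new degree d_i − 1 of i.
  deleteEdge-≼ˡ : Simple G → G i j ≡ true → (deg G i ≡ 1 ⊎ dmax G i j < deg G i) → H i v ≡ true →
                  (deg H i , deg H v) ≼ (deg G i , deg G v)
  deleteEdge-≼ˡ {v} (_ , G-irrefl) Gij descᵢ Hiv =
    subst₂ (λ a b → (deg H i , b) ≼ (a , deg G v))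
           (sym (deg-deleteEdge i≢j Gij)) (deg-cong G H (λ k → sym (deleteEdge-away v≢i v≢j))) (≼-step dᵥ≤dᴴᵢ)
    where
    i≢j : i ≢ j
    i≢j = adj⇒≢ G G-irrefl Gij
    v≢i : v ≢ i
    v≢i refl = adj⇒≢ G G-irrefl (deleteEdge⇒ Hiv) refl
    v≢j : v ≢ j
    v≢j refl with () ← trans (sym Hiv) (deleteEdge-removes i≢j)
    dᵥ<dᵢ : deg G v < deg G i
    dᵥ<dᵢ = [ pendent , ≤-<-trans (dmax-≥ G (deleteEdge⇒ Hiv) v≢j) ]′ descᵢ
      where
      pendent : deg G i ≡ 1 → deg G v < deg G i
      pendent dᵢ≡1 = ⊥-elim (<⇒≢ (adj⇒0<deg H Hiv) (sym (suc-injective (trans (sym (deg-deleteEdge i≢j Gij)) dᵢ≡1))))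
    dᵥ≤dᴴᵢ : deg G v ≤ deg H i
    dᵥ≤dᴴᵢ = ≤-pred (subst (deg G v <_) (deg-deleteEdge i≢j Gij) dᵥ<dᵢ)

module _ {n : ℕ} (G : Adj n) (i j : Fin n) (simple : Simple G) (desc : Descending G i j) where

  private
    H : Adj n
    H = deleteEdge G i j

  deleteEdge-≼-endpoint : u ≡ i ⊎ u ≡ j → H u v ≡ true → (deg H u , deg H v) ≼ (deg G u , deg G v)
  deleteEdge-≼-endpoint (inj₁ refl) Huv = deleteEdge-≼ˡ G i j simple (proj₁ desc) (proj₁ (proj₂ (proj₂ desc))) Huv
  deleteEdge-≼-endpoint {v = v} (inj₂ refl) Huv =
    subst₂ (λ a b → (a , b) ≼ (deg G j , deg G v)) (deg-comm j) (deg-comm v)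
      (deleteEdge-≼ˡ G j i simple (trans (proj₁ simple j i) (proj₁ desc)) (inj₂ (proj₂ (proj₂ (proj₂ desc))))
                     (trans (sym (deleteEdge-comm G i j)) Huv))
    where
    deg-comm : ∀ x → deg (deleteEdge G j i) x ≡ deg H x
    deg-comm x = deg-cong (deleteEdge G j i) H (λ k → sym (deleteEdge-comm G i j))

  deg-deleteEdge-away : ¬ (u ≡ i ⊎ u ≡ j) → deg H u ≡ deg G u
  deg-deleteEdge-away u∉ij = deg-cong H G (λ k → deleteEdge-away G i j (u∉ij ∘ inj₁) (u∉ij ∘ inj₂))

  deleteEdge-≼ : H u v ≡ true → (deg H u , deg H v) ≼ (deg G u , deg G v)
  deleteEdge-≼ {u} {v} Huv with u ≟ i ⊎-dec u ≟ j | v ≟ i ⊎-dec v ≟ j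
  ... | yes u∈ij | _        = deleteEdge-≼-endpoint u∈ij Huv
  ... | no _     | yes v∈ij = ≼-swap (deleteEdge-≼-endpoint v∈ij (trans (deleteEdge-sym G i j (proj₁ simple)) Huv))
  ... | no u∉ij  | no v∉ij  rewrite deg-deleteEdge-away u∉ij | deg-deleteEdge-away v∉ij = ≼-refl

isEdge : Adj n → Fin n × Fin n → Bool
isEdge A (u , v) = A u v ∧ (toℕ u <ᵇ toℕ v)

module _ {n : ℕ} (A : Adj n) where

  isEdge⇒adj : isEdge A (u , v) ≡ true → A u v ≡ true
  isEdge⇒adj {u} {v} e with A u v
  ... | true = refl

  edges≡filter : edges A ≡ filterᵇ (isEdge A) (cartesianProduct (allFin n) (allFin n))
  edges≡filter = rows (allFin n)
    where
    row : ∀ u vs → concatMap (λ v → if A u v ∧ (toℕ u <ᵇ toℕ v) then (u , v) ∷ [] else []) vs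
                   ≡ filterᵇ (isEdge A) (map (u ,_) vs)
    row u [] = refl
    row u (v ∷ vs) with A u v ∧ (toℕ u <ᵇ toℕ v)
    ... | true  = cong ((u , v) ∷_) (row u vs)
    ... | false = row u vs
    rows : ∀ us → concatMap (λ u → concatMap (λ v → if A u v ∧ (toℕ u <ᵇ toℕ v) then (u , v) ∷ [] else [])
                                             (allFin n)) us
                  ≡ filterᵇ (isEdge A) (cartesianProduct us (allFin n))
    rows [] = refl
    rows (u ∷ us) = trans (cong₂ _++_ (row u (allFin n)) (rows us))
                          (sym (filter-++ (T? ∘ isEdge A) (map (u ,_) (allFin n)) _))

  AllL-edges : ∀ {P : Fin n × Fin n → Set} → (∀ {u v} → A u v ≡ true → P (u , v)) → AllL P (edges A)
  AllL-edges adj⇒P =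
    subst (AllL _) (sym edges≡filter) (AllL-filterᵇ (adj⇒P ∘ isEdge⇒adj) (cartesianProduct (allFin n) (allFin n)))

isEdge-deleteEdge : ∀ {n} (G : Adj n) i j {e} → isEdge (deleteEdge G i j) e ≡ true → isEdge G e ≡ true
isEdge-deleteEdge G i j {u , v} Hₑ with deleteEdge G i j u v in Huv
... | true rewrite deleteEdge⇒ G i j Huv = Hₑ

deleteEdge-listed : ∀ {n} (G : Adj n) i j → Simple G → G i j ≡ true →
                    ∃[ e ] isEdge G e ≡ true × isEdge (deleteEdge G i j) e ≡ false
deleteEdge-listed G i j (G-sym , G-irrefl) Gij with <-cmp (toℕ i) (toℕ j)
... | tri< i<j _ _ = (i , j) , cong₂ _∧_ Gij (Equivalence.to T-≡ (<⇒<ᵇ i<j))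
                           , cong (_∧ _) (deleteEdge-removes G i j (adj⇒≢ G G-irrefl Gij))
... | tri≈ _ i=j _ = ⊥-elim (adj⇒≢ G G-irrefl Gij (toℕ-injective i=j))
... | tri> _ _ j<i = (j , i) , cong₂ _∧_ (trans (G-sym j i) Gij) (Equivalence.to T-≡ (<⇒<ᵇ j<i))
                           , cong (_∧ _) (trans (deleteEdge-comm G i j)
                                                (deleteEdge-removes G j i (adj⇒≢ G G-irrefl Gij ∘ sym)))

sum-edges-deleteEdge : ∀ {n} (G : Adj n) i j → Simple G → G i j ≡ true →
  (f g : Fin n × Fin n → ℕ) {m : ℕ} →
  (∀ {u v} → deleteEdge G i j u v ≡ true → f (u , v) ≤ g (u , v)) →
  (∀ {u v} → G u v ≡ true → m ≤ g (u , v)) →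
  sum (map f (edges (deleteEdge G i j))) + m ≤ sum (map g (edges G))
sum-edges-deleteEdge {n} G i j simple Gij f g f≤g m≤g
  rewrite edges≡filter G | edges≡filter (deleteEdge G i j)
  with (u₀ , v₀) , Gₑ₀ , Hₑ₀ ← deleteEdge-listed G i j simple Gij =
    ≤-trans (+-monoʳ-≤ _ (m≤g (isEdge⇒adj G Gₑ₀)))
            (sum-filter-< H⇒G (∈-cartesianProduct⁺ (∈-allFin u₀) (∈-allFin v₀)) Gₑ₀ Hₑ₀)
  where
  H : Adj n
  H = deleteEdge G i j
  H⇒G : ∀ {e} → isEdge H e ≡ true → isEdge G e ≡ true × f e ≤ g e
  H⇒G Hₑ = isEdge-deleteEdge G i j Hₑ , f≤g (isEdge⇒adj H Hₑ)

edgeFloor : ℕ → Adj n → Fin n × Fin n → ℕ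
edgeFloor K A (u , v) = agFloor K (deg A u) (deg A v)

AG>-by-rounding : ∀ {n} N (G H : Adj n) → (∀ u v → H u v ≡ H v u) →
  sum (map (suc ∘ edgeFloor (suc N) H) (edges H)) < sum (map (edgeFloor (suc N) G) (edges G)) → G AG> H
AG>-by-rounding {n} N G H H-sym rounded< =
  lower , upper , AllL-edges G lower-bound , AllL-edges H upper-bound ,
  subst₂ ℚ._<_ (sym (sumℚ-/suc N _ (edges H))) (sym (sumℚ-/suc N _ (edges G))) (/suc-mono-< N rounded<)
  where
  lower upper : Fin n → Fin n → ℚ
  lower u v = edgeFloor (suc N) G (u , v) /suc N
  upper u v = suc (edgeFloor (suc N) H (u , v)) /suc N
  lower-bound : ∀ {u v} → G u v ≡ true → LowerAG (deg G u) (deg G v) (lower u v)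
  lower-bound {u} {v} _ = ScaledLower⇒LowerAG N (deg G u) (deg G v) (edgeFloor (suc N) G (u , v))
                            (agFloor-lower (suc N) (deg G u) (deg G v))
  upper-bound : ∀ {u v} → H u v ≡ true → UpperAG (deg H u) (deg H v) (upper u v)
  upper-bound {u} {v} Huv = ScaledUpper⇒UpperAG N (deg H u) (deg H v) (suc (edgeFloor (suc N) H (u , v)))
                              (agFloor-upper (suc N) (deg H u) (deg H v) (adj⇒0<deg* H H-sym Huv))

corollary7 : (n : ℕ) (G : Adj n) → Simple G → (i j : Fin n) →
    Descending G i j → G AG> deleteEdge G i j
corollary7 n G simple@(G-sym , _) i j desc = AG>-by-rounding N G H H-sym (begin-strict
  sum (map (suc ∘ fᴴ) (edges H))   ≡⟨ sum-map-suc fᴴ (edges H) ⟩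
  sum (map fᴴ (edges H)) + N       <⟨ +-monoʳ-< _ (n<1+n N) ⟩
  sum (map fᴴ (edges H)) + suc N   ≤⟨ sum-edges-deleteEdge G i j simple (proj₁ desc) fᴴ fᴳ floor-mono K≤floor ⟩
  sum (map fᴳ (edges G))           ∎)
  where
  open ≤-Reasoning
  H : Adj n
  H = deleteEdge G i j
  H-sym : ∀ u v → H u v ≡ H v u
  H-sym u v = deleteEdge-sym G i j G-sym
  N : ℕ
  N = length (edges H)
  fᴳ fᴴ : Fin n × Fin n → ℕ
  fᴳ = edgeFloor (suc N) G
  fᴴ = edgeFloor (suc N) H
  floor-mono : ∀ {u v} → H u v ≡ true → fᴴ (u , v) ≤ fᴳ (u , v)
  floor-mono Huv = agFloor-mono (suc N) (deleteEdge-≼ G i j simple desc Huv)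
                     (adj⇒0<deg* H H-sym Huv) (adj⇒0<deg* G G-sym (deleteEdge⇒ G i j Huv))
  K≤floor : ∀ {u v} → G u v ≡ true → suc N ≤ fᴳ (u , v)
  K≤floor {u} {v} Guv = K≤agFloor (suc N) (deg G u) (deg G v) (adj⇒0<deg* G G-sym Guv)
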